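{- Let $U$ be a group on which $SL(2,\mathbb{Z})$ acts from the left by automorphisms, $U_+$ the subgroup fixed by $-I$ (a $PSL(2,\mathbb{Z})$-group), and $M_U(PSL(2,\mathbb{Z}))$ the set of $U$-valued pseudo-measures $J$ with $J(g\alpha,g\beta)=g[J(\alpha,\beta)]$ for all $g\in SL(2,\mathbb{Z})$ (these take values in $U_+$). For such $J$ and $\alpha\in\mathbf{P}^1(\mathbb{Q})$ put $c^J_\alpha(g)=J(g\alpha,\alpha)$ for $g\in PSL(2,\mathbb{Z})$. Then: (i) $c^J_\infty(\sigma)=c^J_\infty(\tau)=J(0,\infty)\in U_+$; (ii) $J\mapsto c^J_\infty$ is a bijection from $M_U(PSL(2,\mathbb{Z}))$ onto the set $Z^1(PSL(2,\mathbb{Z}),U_+)_{cusp}$ of non-commutative $1$-cocycles $c:PSL(2,\mathbb{Z})\to U_+$ (i.e. $c(gh)=c(g)\cdot g[c(h)]$) satisfying $c(\sigma)=c(\tau)$.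
   Context: $\mathbf{P}^1(\mathbb{Q})=\mathbb{Q}\cup\{\infty\}$ with fractional linear action. A $U$-valued pseudo-measure is $J:\mathbf{P}^1(\mathbb{Q})^2\to U$, where $J(\alpha,\beta)$ denotes the value on the segment with ingoing end $\alpha$ and outgoing end $\beta$, satisfying $J(\alpha,\alpha)=1$, $J(\beta,\alpha)J(\alpha,\beta)=1$, $J(\gamma,\alpha)J(\beta,\gamma)J(\alpha,\beta)=1$ for all $\alpha,\beta,\gamma$. $\sigma,\tau$ are the images in $PSL(2,\mathbb{Z})$ of $\begin{pmatrix}0&-1\\1&0\end{pmatrix}$ and $\begin{pmatrix}0&-1\\1&-1\end{pmatrix}$. -}

module Defs where

open import Level using (Level; _⊔_)
open import Data.Nat using (ℕ; suc)
open import Data.Integer as ℤ using (ℤ; +_; -[1+_]; +[1+_]; _*_; _+_; _-_; -_)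
open import Data.Integer.Tactic.RingSolver using (solve-∀)
open import Data.Rational as ℚ using (ℚ)
open import Relation.Binary.PropositionalEquality using (_≡_; refl; trans; cong₂)
open import Algebra.Bundles using (Group)

record SL2Z : Set where
  constructor mkSL2Z
  field
    a b c d : ℤ
    det : a * d - b * c ≡ + 1

open SL2Z public

private
  det-mult : ∀ a b c d e f g h →
    (a * e + b * g) * (c * f + d * h) - (a * f + b * h) * (c * e + d * g)
      ≡ (a * d - b * c) * (e * h - f * g)
  det-mult = solve-∀

infixl 7 _·_
_·_ : SL2Z → SL2Z → SL2Z
g · h = mkSL2Z
  (a g * a h + b g * c h) (a g * b h + b g * d h)
  (c g * a h + d g * c h) (c g * b h + d g * d h)
  (trans (det-mult (a g) (b g) (c g) (d g) (a h) (b h) (c h) (d h))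
         (cong₂ _*_ (det g) (det h)))

I : SL2Z
I = mkSL2Z (+ 1) (+ 0) (+ 0) (+ 1) refl

minusI : SL2Z
minusI = mkSL2Z (- + 1) (+ 0) (+ 0) (- + 1) refl

σ : SL2Z
σ = mkSL2Z (+ 0) (- + 1) (+ 1) (+ 0) refl

τ : SL2Z
τ = mkSL2Z (+ 0) (- + 1) (+ 1) (- + 1) refl

data P1 : Set where
  fin : ℚ → P1
  ∞   : P1

proj : ℤ → ℤ → P1
proj u (+ 0)      = ∞
proj u +[1+ k ]   = fin (u ℚ./ suc k)
proj u -[1+ k ]   = fin ((- u) ℚ./ suc k)

act-P1 : SL2Z → P1 → P1
act-P1 g ∞       = proj (a g) (c g)
act-P1 g (fin x) =
  let p = ℚ.↥ x ; q = ℚ.↧ x in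
  proj (a g * p + b g * q) (c g * p + d g * q)

record SL2Action {c ℓ : Level} (U : Group c ℓ) : Set (c ⊔ ℓ) where
  open Group U
  field
    act      : SL2Z → Carrier → Carrier
    act-cong : ∀ g {x y} → x ≈ y → act g x ≈ act g y
    act-hom  : ∀ g x y → act g (x ∙ y) ≈ act g x ∙ act g y
    act-id   : ∀ x → act I x ≈ x
    act-comp : ∀ g h x → act (g · h) x ≈ act g (act h x)

module _ {c ℓ : Level} {U : Group c ℓ} (A : SL2Action U) where
  open Group U
  open SL2Action A

  InU₊ : Carrier → Set ℓ
  InU₊ x = act minusI x ≈ x

  -- U-valued pseudo-measure on P¹(ℚ); J α β is the value on the segment
  -- with ingoing end α and outgoing end β
  record IsPseudoMeasure (J : P1 → P1 → Carrier) : Set ℓ where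
    field
      refl-ε  : ∀ α → J α α ≈ ε
      inverse : ∀ α β → J β α ∙ J α β ≈ ε
      cocyc   : ∀ α β γ → J γ α ∙ J β γ ∙ J α β ≈ ε

  record IsInvariantPseudoMeasure (J : P1 → P1 → Carrier) : Set ℓ where
    field
      pseudo      : IsPseudoMeasure J
      equivariant : ∀ g α β → J (act-P1 g α) (act-P1 g β) ≈ act g (J α β)

  cJ : (P1 → P1 → Carrier) → P1 → SL2Z → Carrier
  cJ J α g = J (act-P1 g α) α

  -- Z¹(PSL(2,ℤ), U₊)_cusp : functions on PSL(2,ℤ) (i.e. functions on
  -- SL(2,ℤ) invariant under g ↦ -g) with values in U₊, satisfying the
  -- non-commutative cocycle relation and c(σ) = c(τ)
  record IsCuspCocycle (f : SL2Z → Carrier) : Set (c ⊔ ℓ) where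
    field
      onPSL   : ∀ g → f (minusI · g) ≈ f g
      valU₊   : ∀ g → InU₊ (f g)
      cocycle : ∀ g h → f (g · h) ≈ f g ∙ act g (f h)
      cusp    : f σ ≈ f τ

-- A pseudo-measure is determined by its values at the cusp ∞: the cocycle relation gives
-- J(α,β) = J(β,∞)⁻¹ J(α,∞), and since SL(2,ℤ) acts transitively on P¹(ℚ) (Bézout completes
-- a reduced fraction to a matrix g with g∞ = α), equivariance identifies J(α,∞) with c(g) for
-- c = c^J_∞, which is a cocycle because J(gh∞,∞) = J(g∞,∞) J(gh∞,g∞).  Conversely a cocycle c
-- gives J(α,β) = c(g_β)⁻¹ c(g_α) for chosen g_α with g_α∞ = α; this J is equivariant as soon as
-- c(g) depends only on g∞, i.e. c vanishes on the stabiliser {±(1 y; 0 1)} of ∞.  That is the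
-- content of c(σ) = c(τ): c(στ) = c(σ) σ[c(σ)] = c(σ²) = c(-I) = 1, and στ = -(1 -1; 0 1).

module Submission where

open import Defs
open import Level using (Level)
open import Algebra.Bundles using (Group)
open import Data.Product using (Σ; _×_; _,_; proj₁; proj₂)
open import Data.Integer as ℤ using (ℤ; +_; +[1+_]; -[1+_]; 0ℤ; 1ℤ; -1ℤ; ∣_∣; -_; _+_; _-_; _*_)
open import Data.Rational using (_/_; mkℚ; ↥_; ↧_)
open import Data.Nat as ℕ using (suc)
import Data.Nat.Properties as ℕ
open import Data.Nat.Coprimality as Coprimality using (Coprime; coprime-Bézout)
open import Data.Nat.GCD using (module Bézout)
import Data.Integer.Properties as ℤ
open import Data.Integer.Tactic.RingSolver using (solve-∀)
open import Data.Rational.Unnormalised using (mkℚᵘ; *≡*)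
import Data.Rational.Properties as ℚ
open import Data.Sum using (_⊎_; inj₁; inj₂)
open import Data.Empty using (⊥-elim)
open import Relation.Nullary using (¬_)
open import Relation.Binary.PropositionalEquality as ≡ using (_≡_)
open import Axiom.UniquenessOfIdentityProofs using (module Decidable⇒UIP)

module SL2Z-Action where
  open ≡

  SL2Z-≡ : ∀ {g h} → a g ≡ a h → b g ≡ b h → c g ≡ c h → d g ≡ d h → g ≡ h
  SL2Z-≡ {mkSL2Z _ _ _ _ p} {mkSL2Z _ _ _ _ q} refl refl refl refl =
    cong (mkSL2Z _ _ _ _) (Decidable⇒UIP.≡-irrelevant ℤ._≟_ p q)

  T : ℤ → SL2Z
  T y = mkSL2Z 1ℤ y 0ℤ 1ℤ (cong (λ z → 1ℤ - z) (ℤ.*-zeroʳ y))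

  T-+ : ∀ y z → T y · T z ≡ T (y + z)
  T-+ y z = SL2Z-≡ (cong (λ z → 1ℤ + z) (ℤ.*-zeroʳ y)) (b-entry y z) refl refl
    where
    b-entry : ∀ y z → 1ℤ * z + y * 1ℤ ≡ y + z
    b-entry = solve-∀

  T-0 : T 0ℤ ≡ I
  T-0 = SL2Z-≡ refl refl refl refl

  σ²≡-I : σ · σ ≡ minusI
  σ²≡-I = SL2Z-≡ refl refl refl refl

  στ≡-T-1 : σ · τ ≡ minusI · T -1ℤ
  στ≡-T-1 = SL2Z-≡ refl refl refl refl

  adjugate : SL2Z → SL2Z
  adjugate g = mkSL2Z (d g) (- b g) (- c g) (a g)
    (trans (adj-det (a g) (b g) (c g) (d g)) (det g))
    where
    adj-det : ∀ a b c d → d * a - (- b) * (- c) ≡ a * d - b * c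
    adj-det = solve-∀

  det*-identityˡ : ∀ g w → (a g * d g - b g * c g) * w ≡ w
  det*-identityˡ g w = trans (cong (_* w) (det g)) (ℤ.*-identityˡ w)

  adjugate-cancelˡ : ∀ g h → g · (adjugate g · h) ≡ h
  adjugate-cancelˡ g h =
    SL2Z-≡ (first (a h) (c h)) (first (b h) (d h)) (second (a h) (c h)) (second (b h) (d h))
    where
    first-adj : ∀ a b c d x y → a * (d * x + (- b) * y) + b * ((- c) * x + a * y) ≡ (a * d - b * c) * x
    first-adj = solve-∀
    second-adj : ∀ a b c d x y → c * (d * x + (- b) * y) + d * ((- c) * x + a * y) ≡ (a * d - b * c) * y
    second-adj = solve-∀
    first : ∀ x y → a g * (d g * x + (- b g) * y) + b g * ((- c g) * x + a g * y) ≡ x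
    first x y = trans (first-adj (a g) (b g) (c g) (d g) x y) (det*-identityˡ g x)
    second : ∀ x y → c g * (d g * x + (- b g) * y) + d g * ((- c g) * x + a g * y) ≡ y
    second x y = trans (second-adj (a g) (b g) (c g) (d g) x y) (det*-identityˡ g y)

  i*j≡1⇒±1 : ∀ i j → i * j ≡ 1ℤ → (i ≡ 1ℤ × j ≡ 1ℤ) ⊎ (i ≡ -1ℤ × j ≡ -1ℤ)
  i*j≡1⇒±1 i j ij≡1
    with unit i (ℕ.m*n≡1⇒m≡1 ∣ i ∣ ∣ j ∣ ∣i∣∣j∣≡1) | unit j (ℕ.m*n≡1⇒n≡1 ∣ i ∣ ∣ j ∣ ∣i∣∣j∣≡1)
    where
    ∣i∣∣j∣≡1 : ∣ i ∣ ℕ.* ∣ j ∣ ≡ 1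
    ∣i∣∣j∣≡1 = trans (sym (ℤ.abs-* i j)) (cong ∣_∣ ij≡1)
    unit : ∀ x → ∣ x ∣ ≡ 1 → x ≡ 1ℤ ⊎ x ≡ -1ℤ
    unit (+ _)        refl = inj₁ refl
    unit -[1+ 0 ]     _    = inj₂ refl
  ... | inj₁ refl | inj₁ refl = inj₁ (refl , refl)
  ... | inj₂ refl | inj₂ refl = inj₂ (refl , refl)
  ... | inj₁ refl | inj₂ refl with () ← ij≡1
  ... | inj₂ refl | inj₁ refl with () ← ij≡1

  c≡0⇒±T : ∀ t → c t ≡ 0ℤ → t ≡ T (b t) ⊎ t ≡ minusI · T (- b t)
  c≡0⇒±T (mkSL2Z a b _ d ad-b0≡1) refl with i*j≡1⇒±1 a d (trans (sym (ad-b0≡ad a b d)) ad-b0≡1)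
    where
    ad-b0≡ad : ∀ a b d → a * d - b * 0ℤ ≡ a * d
    ad-b0≡ad = solve-∀
  ... | inj₁ (refl , refl) = inj₁ (SL2Z-≡ refl refl refl refl)
  ... | inj₂ (refl , refl) = inj₂ (SL2Z-≡ refl (sym (b-entry b)) refl refl)
    where
    b-entry : ∀ b → -1ℤ * (- b) + 0ℤ * 1ℤ ≡ b
    b-entry = solve-∀

  NonZero₂ : ℤ → ℤ → Set
  NonZero₂ u v = ¬ (u ≡ 0ℤ × v ≡ 0ℤ)

  cross-negˡ : ∀ u v u' v' → u * v' ≡ u' * v → (- u) * v' ≡ u' * (- v)
  cross-negˡ u v u' v' eq =
    trans (sym (ℤ.neg-distribˡ-* u v')) (trans (cong -_ eq) (ℤ.neg-distribʳ-* u' v))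

  cross-zero : ∀ u u' v' → NonZero₂ u 0ℤ → u * v' ≡ u' * 0ℤ → v' ≡ 0ℤ
  cross-zero u u' v' nz eq with ℤ.i*j≡0⇒i≡0∨j≡0 u (trans eq (ℤ.*-zeroʳ u'))
  ... | inj₁ u≡0  = ⊥-elim (nz (u≡0 , refl))
  ... | inj₂ v'≡0 = v'≡0

  proj-cong⁺ : ∀ u k u' k' → u * +[1+ k' ] ≡ u' * +[1+ k ] → proj u +[1+ k ] ≡ proj u' +[1+ k' ]
  proj-cong⁺ u k u' k' eq = cong fin (ℚ.fromℚᵘ-cong {mkℚᵘ u k} {mkℚᵘ u' k'} (*≡* eq))

  proj-injective⁺ : ∀ u k u' k' → proj u +[1+ k ] ≡ proj u' +[1+ k' ] → u * +[1+ k' ] ≡ u' * +[1+ k ]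
  proj-injective⁺ u k u' k' eq with ℚ.fromℚᵘ-injective {mkℚᵘ u k} {mkℚᵘ u' k'} (fin-injective eq)
    where
    fin-injective : ∀ {r s} → fin r ≡ fin s → r ≡ s
    fin-injective refl = refl
  ... | *≡* eq′ = eq′

  proj-congˡ⁺ : ∀ u k u' v' → NonZero₂ u' v' → u * v' ≡ u' * +[1+ k ] → proj u +[1+ k ] ≡ proj u' v'
  proj-congˡ⁺ u k u' (+ 0)     nz' eq with () ← cross-zero u' u +[1+ k ] nz' (sym eq)
  proj-congˡ⁺ u k u' +[1+ k' ] _   eq = proj-cong⁺ u k u' k' eq
  proj-congˡ⁺ u k u' -[1+ k' ] _   eq =
    proj-cong⁺ u k (- u') k' (sym (cross-negˡ u' -[1+ k' ] u +[1+ k ] (sym eq)))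

  proj-cong : ∀ {u v u' v'} → NonZero₂ u v → NonZero₂ u' v' → u * v' ≡ u' * v → proj u v ≡ proj u' v'
  proj-cong {v = + 0}      {v' = + 0}      _ _ _ = refl
  proj-cong {u} {+ 0} {u'} {v'@(+[1+ _ ])} nz _ eq with () ← cross-zero u u' v' nz eq
  proj-cong {u} {+ 0} {u'} {v'@(-[1+ _ ])} nz _ eq with () ← cross-zero u u' v' nz eq
  proj-cong {u} {+[1+ k ]} {u'} {v'} _ nz' eq = proj-congˡ⁺ u k u' v' nz' eq
  proj-cong {u} { -[1+ k ]} {u'} {v'} _ nz' eq =
    proj-congˡ⁺ (- u) k u' v' nz' (cross-negˡ u -[1+ k ] u' v' eq)

  proj-injectiveˡ⁺ : ∀ u k u' v' → proj u +[1+ k ] ≡ proj u' v' → u * v' ≡ u' * +[1+ k ]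
  proj-injectiveˡ⁺ u k u' +[1+ k' ] eq = proj-injective⁺ u k u' k' eq
  proj-injectiveˡ⁺ u k u' -[1+ k' ] eq = begin
    u * -[1+ k' ]       ≡⟨ cross-negˡ (- u') +[1+ k' ] u +[1+ k ] (sym (proj-injective⁺ u k (- u') k' eq)) ⟨
    - - u' * +[1+ k ]   ≡⟨ cong (_* +[1+ k ]) (ℤ.neg-involutive u') ⟩
    u' * +[1+ k ]       ∎
    where open ≡-Reasoning

  proj-injective : ∀ {u v u' v'} → proj u v ≡ proj u' v' → u * v' ≡ u' * v
  proj-injective {u} {+ 0} {u'} {+ 0} _ = trans (ℤ.*-zeroʳ u) (sym (ℤ.*-zeroʳ u'))
  proj-injective {v = + 0} {v' = +[1+ _ ]} ()
  proj-injective {v = + 0} {v' = -[1+ _ ]} ()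
  proj-injective {u} {+[1+ k ]} {u'} {v'} eq = proj-injectiveˡ⁺ u k u' v' eq
  proj-injective {u} { -[1+ k ]} {u'} {v'} eq = begin
    u * v'              ≡⟨ cong (_* v') (ℤ.neg-involutive u) ⟨
    - - u * v'          ≡⟨ cross-negˡ (- u) +[1+ k ] u' v' (proj-injectiveˡ⁺ (- u) k u' v' eq) ⟩
    u' * -[1+ k ]       ∎
    where open ≡-Reasoning

  num den : P1 → ℤ
  num ∞       = 1ℤ
  num (fin r) = ↥ r
  den ∞       = 0ℤ
  den (fin r) = ↧ r

  proj-num-den : ∀ α → proj (num α) (den α) ≡ α
  proj-num-den ∞                   = refl
  proj-num-den (fin r@(mkℚ _ _ _)) = cong fin (ℚ.↥p/↧p≡p r)

  num-den-nonzero : ∀ α → NonZero₂ (num α) (den α)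
  num-den-nonzero ∞               (() , _)
  num-den-nonzero (fin (mkℚ _ _ _)) (_ , ())

  image-nonzero : ∀ g {u v} → NonZero₂ u v → NonZero₂ (a g * u + b g * v) (c g * u + d g * v)
  image-nonzero g {u} {v} nz (x≡0 , y≡0) =
    nz (recover u (d g) (b g) (adj-first (a g) (b g) (c g) (d g) u v) x≡0 y≡0 ,
        recover v (a g) (c g) (adj-second (a g) (b g) (c g) (d g) u v) y≡0 x≡0)
    where
    open ≡-Reasoning
    adj-first : ∀ a b c d u v → (a * d - b * c) * u ≡ d * (a * u + b * v) - b * (c * u + d * v)
    adj-first = solve-∀
    adj-second : ∀ a b c d u v → (a * d - b * c) * v ≡ a * (c * u + d * v) - c * (a * u + b * v)
    adj-second = solve-∀
    vanish : ∀ p q → p * 0ℤ - q * 0ℤ ≡ 0ℤ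
    vanish = solve-∀
    recover : ∀ w p q {x y} → (a g * d g - b g * c g) * w ≡ p * x - q * y → x ≡ 0ℤ → y ≡ 0ℤ → w ≡ 0ℤ
    recover w p q eq refl refl = begin
      w                               ≡⟨ det*-identityˡ g w ⟨
      (a g * d g - b g * c g) * w     ≡⟨ eq ⟩
      p * 0ℤ - q * 0ℤ                 ≡⟨ vanish p q ⟩
      0ℤ                              ∎

  linear-cross : ∀ g {p q u v} → p * v ≡ u * q →
    (a g * p + b g * q) * (c g * u + d g * v) ≡ (a g * u + b g * v) * (c g * p + d g * q)
  linear-cross g {p} {q} {u} {v} eq = ℤ.i-j≡0⇒i≡j _ _ (begin
    (a g * p + b g * q) * (c g * u + d g * v) - (a g * u + b g * v) * (c g * p + d g * q)
      ≡⟨ det-factor (a g) (b g) (c g) (d g) p q u v ⟩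
    (a g * d g - b g * c g) * (p * v - u * q)
      ≡⟨ cong (λ z → (a g * d g - b g * c g) * z) (ℤ.i≡j⇒i-j≡0 eq) ⟩
    (a g * d g - b g * c g) * 0ℤ              ≡⟨ ℤ.*-zeroʳ (a g * d g - b g * c g) ⟩
    0ℤ                                        ∎)
    where
    open ≡-Reasoning
    det-factor : ∀ a b c d p q u v →
      (a * p + b * q) * (c * u + d * v) - (a * u + b * v) * (c * p + d * q) ≡ (a * d - b * c) * (p * v - u * q)
    det-factor = solve-∀

  act-P1-num-den : ∀ g α → act-P1 g α ≡ proj (a g * num α + b g * den α) (c g * num α + d g * den α)
  act-P1-num-den g ∞       = cong₂ proj (first-column (a g) (b g)) (first-column (c g) (d g))
    where
    first-column : ∀ x y → x ≡ x * 1ℤ + y * 0ℤ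
    first-column = solve-∀
  act-P1-num-den g (fin r) = refl

  act-P1-proj : ∀ g {u v} → NonZero₂ u v → act-P1 g (proj u v) ≡ proj (a g * u + b g * v) (c g * u + d g * v)
  act-P1-proj g {u} {v} nz = trans (act-P1-num-den g α)
    (proj-cong (image-nonzero g (num-den-nonzero α)) (image-nonzero g nz)
               (linear-cross g (proj-injective (proj-num-den α))))
    where α = proj u v

  act-P1-∘ : ∀ g h α → act-P1 (g · h) α ≡ act-P1 g (act-P1 h α)
  act-P1-∘ g h α = begin
    act-P1 (g · h) α                              ≡⟨ act-P1-num-den (g · h) α ⟩
    proj _ _                                      ≡⟨ cong₂ proj (row (a g) (b g)) (row (c g) (d g)) ⟩
    proj (a g * x + b g * y) (c g * x + d g * y)  ≡⟨ act-P1-proj g (image-nonzero h (num-den-nonzero α)) ⟨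
    act-P1 g (proj x y)                           ≡⟨ cong (act-P1 g) (act-P1-num-den h α) ⟨
    act-P1 g (act-P1 h α)                         ∎
    where
    open ≡-Reasoning
    x = a h * num α + b h * den α
    y = c h * num α + d h * den α
    matrix-assoc : ∀ e f p q r s m n →
      (e * p + f * r) * m + (e * q + f * s) * n ≡ e * (p * m + q * n) + f * (r * m + s * n)
    matrix-assoc = solve-∀
    row : ∀ e f → (e * a h + f * c h) * num α + (e * b h + f * d h) * den α ≡ e * x + f * y
    row e f = matrix-assoc e f (a h) (b h) (c h) (d h) (num α) (den α)

  act-P1-minusI : ∀ α → act-P1 minusI α ≡ α
  act-P1-minusI α = begin
    act-P1 minusI α          ≡⟨ act-P1-num-den minusI α ⟩
    proj _ _                 ≡⟨ proj-cong (image-nonzero minusI nz) nz (negate (num α) (den α)) ⟩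
    proj (num α) (den α)     ≡⟨ proj-num-den α ⟩
    α                        ∎
    where
    open ≡-Reasoning
    nz = num-den-nonzero α
    negate : ∀ p q → (-1ℤ * p + 0ℤ * q) * q ≡ p * (0ℤ * p + -1ℤ * q)
    negate = solve-∀

  ℕ-Bézout⇒ℤ : ∀ x y m q → 1 ℕ.+ y ℕ.* q ≡ x ℕ.* m → + x * + m - + y * + q ≡ 1ℤ
  ℕ-Bézout⇒ℤ x y m q eq = begin
    + x * + m - + y * + q            ≡⟨ cong₂ _-_ (ℤ.pos-* x m) (ℤ.pos-* y q) ⟨
    + (x ℕ.* m) - + (y ℕ.* q)        ≡⟨ cong (λ z → + z - + (y ℕ.* q)) eq ⟨
    1ℤ + + (y ℕ.* q) - + (y ℕ.* q)   ≡⟨ cancel (+ (y ℕ.* q)) ⟩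
    1ℤ                               ∎
    where
    open ≡-Reasoning
    cancel : ∀ z → 1ℤ + z - z ≡ 1ℤ
    cancel = solve-∀

  Bézout⇒ℤ : ∀ {m q} → Bézout.Identity 1 m q → Σ ℤ λ r → Σ ℤ λ s → + m * s - r * + q ≡ 1ℤ
  Bézout⇒ℤ {m} {q} (Bézout.+- x y eq) =
    + y , + x , trans (cong (_- + y * + q) (ℤ.*-comm (+ m) (+ x))) (ℕ-Bézout⇒ℤ x y m q eq)
  Bézout⇒ℤ {m} {q} (Bézout.-+ x y eq) =
    - + y , - + x , trans (swap (+ m) (+ x) (+ y) (+ q)) (ℕ-Bézout⇒ℤ y x q m eq)
    where
    swap : ∀ m x y q → m * (- x) - (- y) * q ≡ y * q - x * m
    swap = solve-∀

  coprime⇒Bézout : ∀ n k → Coprime ∣ n ∣ (suc k) → Σ ℤ λ r → Σ ℤ λ s → n * s - r * +[1+ k ] ≡ 1ℤ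
  coprime⇒Bézout (+ m)    k cop = Bézout⇒ℤ (coprime-Bézout cop)
  coprime⇒Bézout -[1+ m ] k cop with Bézout⇒ℤ (coprime-Bézout cop)
  ... | r , s , eq = r , - s , trans (cong (_- r * +[1+ k ]) (neg-neg +[1+ m ] s)) eq
    where
    neg-neg : ∀ i j → (- i) * (- j) ≡ i * j
    neg-neg = solve-∀

  carry∞ : P1 → SL2Z
  carry∞ ∞                   = I
  carry∞ (fin (mkℚ n k cop)) = mkSL2Z n r +[1+ k ] s ns-rk≡1
    where
    bz = coprime⇒Bézout n k (Coprimality.recompute cop)
    r = proj₁ bz
    s = proj₁ (proj₂ bz)
    ns-rk≡1 = proj₂ (proj₂ bz)

  act-P1-carry∞ : ∀ α → act-P1 (carry∞ α) ∞ ≡ α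
  act-P1-carry∞ ∞                   = refl
  act-P1-carry∞ (fin r@(mkℚ _ _ _)) = proj-num-den (fin r)

  g∞≡h∞⇒c[g⁻¹h]≡0 : ∀ g h → act-P1 g ∞ ≡ act-P1 h ∞ → c (adjugate g · h) ≡ 0ℤ
  g∞≡h∞⇒c[g⁻¹h]≡0 g h eq = begin
    (- c g) * a h + a g * c h   ≡⟨ cong (λ z → (- c g) * a h + z) (proj-injective eq) ⟩
    (- c g) * a h + a h * c g   ≡⟨ cancel (c g) (a h) ⟩
    0ℤ                          ∎
    where
    open ≡-Reasoning
    cancel : ∀ x y → (- x) * y + y * x ≡ 0ℤ
    cancel = solve-∀

open SL2Z-Action

module _ {u ℓ : Level} {U : Group u ℓ} (A : SL2Action U) where
  open Group U
  open SL2Action A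
  open import Algebra.Properties.Group U
  open import Relation.Binary.Reasoning.Setoid setoid

  act-ε : ∀ g → act g ε ≈ ε
  act-ε g = identityˡ-unique (act g ε) (act g ε) (begin
    act g ε ∙ act g ε  ≈⟨ act-hom g ε ε ⟨
    act g (ε ∙ ε)      ≈⟨ act-cong g (identityˡ ε) ⟩
    act g ε            ∎)

  act-⁻¹ : ∀ g x → act g (x ⁻¹) ≈ act g x ⁻¹
  act-⁻¹ g x = inverseˡ-unique (act g (x ⁻¹)) (act g x) (begin
    act g (x ⁻¹) ∙ act g x  ≈⟨ act-hom g (x ⁻¹) x ⟨
    act g (x ⁻¹ ∙ x)        ≈⟨ act-cong g (inverseˡ x) ⟩
    act g ε                 ≈⟨ act-ε g ⟩
    ε                       ∎)

  J-cong : (J : P1 → P1 → Carrier) → ∀ {α α′ β β′} → α ≡ α′ → β ≡ β′ → J α β ≈ J α′ β′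
  J-cong J α≡α′ β≡β′ = reflexive (≡.cong₂ J α≡α′ β≡β′)

  module _ {J : P1 → P1 → Carrier} (isPM : IsPseudoMeasure A J) where
    open IsPseudoMeasure isPM renaming (inverse to J-inverse)

    pseudoMeasure-split : ∀ α β γ → J α β ≈ J γ β ∙ J α γ
    pseudoMeasure-split α β γ = begin
      J α β                    ≈⟨ inverseʳ-unique (J γ α ∙ J β γ) (J α β) (cocyc α β γ) ⟩
      (J γ α ∙ J β γ) ⁻¹       ≈⟨ ⁻¹-anti-homo-∙ (J γ α) (J β γ) ⟩
      J β γ ⁻¹ ∙ J γ α ⁻¹
        ≈⟨ ∙-cong (inverseˡ-unique _ _ (J-inverse β γ)) (inverseˡ-unique _ _ (J-inverse γ α)) ⟨
      J γ β ∙ J α γ            ∎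

    pseudoMeasure≈ratio : ∀ α β → J α β ≈ J β ∞ \\ J α ∞
    pseudoMeasure≈ratio α β = trans (pseudoMeasure-split α β ∞)
                                    (∙-congʳ (inverseˡ-unique _ _ (J-inverse β ∞)))

  ratio : (P1 → Carrier) → P1 → P1 → Carrier
  ratio F α β = F β \\ F α

  ratio-isPseudoMeasure : ∀ F → IsPseudoMeasure A (ratio F)
  ratio-isPseudoMeasure F = record
    { refl-ε  = λ α → inverseˡ (F α)
    ; inverse = λ α β → trans (telescope (F α) (F β) (F α)) (inverseˡ (F α))
    ; cocyc   = λ α β γ → trans (∙-congʳ (telescope (F α) (F γ) (F β)))
                                (trans (telescope (F α) (F β) (F α)) (inverseˡ (F α)))
    }
    where
    telescope : ∀ x y z → (x \\ y) ∙ (y \\ z) ≈ x \\ z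
    telescope x y z = begin
      (x \\ y) ∙ (y \\ z)  ≈⟨ assoc (x ⁻¹) y (y \\ z) ⟩
      x ⁻¹ ∙ (y ∙ (y \\ z)) ≈⟨ ∙-congˡ (\\-leftDividesˡ y z) ⟩
      x \\ z               ∎

  ratio-equivariant : ∀ {F : P1 → Carrier} {f : SL2Z → Carrier} →
    (∀ g α → F (act-P1 g α) ≈ f g ∙ act g (F α)) →
    ∀ g α β → ratio F (act-P1 g α) (act-P1 g β) ≈ act g (ratio F α β)
  ratio-equivariant {F} {f} F-twisted g α β = begin
    F (act-P1 g β) \\ F (act-P1 g α)                 ≈⟨ \\-cong₂ (F-twisted g β) (F-twisted g α) ⟩
    (f g ∙ act g (F β)) \\ (f g ∙ act g (F α))       ≈⟨ ∙-congʳ (⁻¹-anti-homo-∙ (f g) (act g (F β))) ⟩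
    (act g (F β) ⁻¹ ∙ f g ⁻¹) ∙ (f g ∙ act g (F α))  ≈⟨ assoc _ _ _ ⟩
    act g (F β) ⁻¹ ∙ (f g \\ (f g ∙ act g (F α)))
      ≈⟨ ∙-cong (sym (act-⁻¹ g (F β))) (\\-leftDividesʳ (f g) (act g (F α))) ⟩
    act g (F β ⁻¹) ∙ act g (F α)                     ≈⟨ act-hom g (F β ⁻¹) (F α) ⟨
    act g (F β \\ F α)                               ∎

  module _ {J : P1 → P1 → Carrier} (isInv : IsInvariantPseudoMeasure A J) where
    open IsInvariantPseudoMeasure isInv

    invariant⇒InU₊ : ∀ α β → InU₊ A (J α β)
    invariant⇒InU₊ α β =
      trans (sym (equivariant minusI α β)) (J-cong J (act-P1-minusI α) (act-P1-minusI β))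

    cJ-isCuspCocycle : IsCuspCocycle A (cJ A J ∞)
    cJ-isCuspCocycle = record
      { onPSL   = λ g → J-cong J (≡.trans (act-P1-∘ minusI g ∞) (act-P1-minusI _)) ≡.refl
      ; valU₊   = λ g → invariant⇒InU₊ (act-P1 g ∞) ∞
      ; cocycle = λ g h → begin
          J (act-P1 (g · h) ∞) ∞
            ≈⟨ J-cong J (act-P1-∘ g h ∞) ≡.refl ⟩
          J (act-P1 g (act-P1 h ∞)) ∞
            ≈⟨ pseudoMeasure-split pseudo _ _ (act-P1 g ∞) ⟩
          J (act-P1 g ∞) ∞ ∙ J (act-P1 g (act-P1 h ∞)) (act-P1 g ∞)
            ≈⟨ ∙-congˡ (equivariant g _ ∞) ⟩
          J (act-P1 g ∞) ∞ ∙ act g (J (act-P1 h ∞) ∞)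
            ∎
      ; cusp    = refl
      }

  cJ-injective : ∀ {J J′} → IsInvariantPseudoMeasure A J → IsInvariantPseudoMeasure A J′ →
    (∀ g → cJ A J ∞ g ≈ cJ A J′ ∞ g) → ∀ α β → J α β ≈ J′ α β
  cJ-injective {J} {J′} isInv isInv′ cJ≈cJ′ α β = begin
    J α β              ≈⟨ pseudoMeasure≈ratio (IsInvariantPseudoMeasure.pseudo isInv) α β ⟩
    J β ∞ \\ J α ∞     ≈⟨ \\-cong₂ (agree β) (agree α) ⟩
    J′ β ∞ \\ J′ α ∞   ≈⟨ pseudoMeasure≈ratio (IsInvariantPseudoMeasure.pseudo isInv′) α β ⟨
    J′ α β             ∎
    where
    agree : ∀ γ → J γ ∞ ≈ J′ γ ∞
    agree γ = begin
      J γ ∞                       ≈⟨ J-cong J (act-P1-carry∞ γ) ≡.refl ⟨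
      J (act-P1 (carry∞ γ) ∞) ∞   ≈⟨ cJ≈cJ′ (carry∞ γ) ⟩
      J′ (act-P1 (carry∞ γ) ∞) ∞  ≈⟨ J-cong J′ (act-P1-carry∞ γ) ≡.refl ⟩
      J′ γ ∞                      ∎

  module Cocycle {f : SL2Z → Carrier} (cocycle : ∀ g h → f (g · h) ≈ f g ∙ act g (f h)) where

    cocycle-I : f I ≈ ε
    cocycle-I = identityˡ-unique (f I) (f I) (begin
      f I ∙ f I          ≈⟨ ∙-congˡ (act-id (f I)) ⟨
      f I ∙ act I (f I)  ≈⟨ cocycle I I ⟨
      f (I · I)          ≡⟨⟩
      f I                ∎)

    cocycle-·-trivialʳ : ∀ g h → f h ≈ ε → f (g · h) ≈ f g
    cocycle-·-trivialʳ g h fh≈ε = begin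
      f (g · h)          ≈⟨ cocycle g h ⟩
      f g ∙ act g (f h)  ≈⟨ ∙-congˡ (trans (act-cong g fh≈ε) (act-ε g)) ⟩
      f g ∙ ε            ≈⟨ identityʳ (f g) ⟩
      f g                ∎

    cocycle-·-trivial : ∀ g h → f g ≈ ε → f h ≈ ε → f (g · h) ≈ ε
    cocycle-·-trivial g h fg≈ε fh≈ε = trans (cocycle-·-trivialʳ g h fh≈ε) fg≈ε

  module _ {f : SL2Z → Carrier} (isCusp : IsCuspCocycle A f) where
    open IsCuspCocycle isCusp
    open Cocycle {f} cocycle

    cusp-T-1 : f (T -1ℤ) ≈ ε
    cusp-T-1 = begin
      f (T -1ℤ)           ≈⟨ onPSL (T -1ℤ) ⟨
      f (minusI · T -1ℤ)  ≡⟨ ≡.cong f στ≡-T-1 ⟨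
      f (σ · τ)           ≈⟨ cocycle σ τ ⟩
      f σ ∙ act σ (f τ)   ≈⟨ ∙-congˡ (act-cong σ cusp) ⟨
      f σ ∙ act σ (f σ)   ≈⟨ cocycle σ σ ⟨
      f (σ · σ)           ≡⟨ ≡.cong f σ²≡-I ⟩
      f minusI            ≈⟨ cocycle-·-trivialʳ minusI I cocycle-I ⟨
      f (minusI · I)      ≈⟨ onPSL I ⟩
      f I                 ≈⟨ cocycle-I ⟩
      ε                   ∎

    cusp-T1 : f (T 1ℤ) ≈ ε
    cusp-T1 = begin
      f (T 1ℤ)            ≈⟨ cocycle-·-trivialʳ (T 1ℤ) (T -1ℤ) cusp-T-1 ⟨
      f (T 1ℤ · T -1ℤ)    ≡⟨ ≡.cong f (≡.trans (T-+ 1ℤ -1ℤ) T-0) ⟩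
      f I                 ≈⟨ cocycle-I ⟩
      ε                   ∎

    cusp-T : ∀ y → f (T y) ≈ ε
    cusp-T (+ 0)            = trans (reflexive (≡.cong f T-0)) cocycle-I
    cusp-T +[1+ n ]         = begin
      f (T +[1+ n ])            ≡⟨ ≡.cong f (T-+ 1ℤ (+ n)) ⟨
      f (T 1ℤ · T (+ n))        ≈⟨ cocycle-·-trivial (T 1ℤ) (T (+ n)) cusp-T1 (cusp-T (+ n)) ⟩
      ε                         ∎
    cusp-T -[1+ 0 ]         = cusp-T-1
    cusp-T -[1+ suc n ]     = begin
      f (T -[1+ suc n ])        ≡⟨ ≡.cong f (T-+ -1ℤ -[1+ n ]) ⟨
      f (T -1ℤ · T -[1+ n ])    ≈⟨ cocycle-·-trivial (T -1ℤ) (T -[1+ n ]) cusp-T-1 (cusp-T -[1+ n ]) ⟩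
      ε                         ∎

    cusp-stabilizer : ∀ t → c t ≡ 0ℤ → f t ≈ ε
    cusp-stabilizer t c≡0 with c≡0⇒±T t c≡0
    ... | inj₁ t≡T  = trans (reflexive (≡.cong f t≡T)) (cusp-T (b t))
    ... | inj₂ t≡-T = trans (reflexive (≡.cong f t≡-T)) (trans (onPSL (T (- b t))) (cusp-T (- b t)))

    cusp-∞-invariant : ∀ g h → act-P1 g ∞ ≡ act-P1 h ∞ → f h ≈ f g
    cusp-∞-invariant g h g∞≡h∞ = begin
      f h                       ≡⟨ ≡.cong f (adjugate-cancelˡ g h) ⟨
      f (g · (adjugate g · h))  ≈⟨ cocycle-·-trivialʳ g (adjugate g · h) f[g⁻¹h]≈ε ⟩
      f g                       ∎
      where
      f[g⁻¹h]≈ε : f (adjugate g · h) ≈ ε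
      f[g⁻¹h]≈ε = cusp-stabilizer (adjugate g · h) (g∞≡h∞⇒c[g⁻¹h]≡0 g h g∞≡h∞)

    cusp-carry∞-twisted : ∀ g α → f (carry∞ (act-P1 g α)) ≈ f g ∙ act g (f (carry∞ α))
    cusp-carry∞-twisted g α =
      trans (cusp-∞-invariant (g · carry∞ α) (carry∞ (act-P1 g α)) same-point) (cocycle g (carry∞ α))
      where
      same-point : act-P1 (g · carry∞ α) ∞ ≡ act-P1 (carry∞ (act-P1 g α)) ∞
      same-point = ≡.trans (act-P1-∘ g (carry∞ α) ∞)
        (≡.trans (≡.cong (act-P1 g) (act-P1-carry∞ α)) (≡.sym (act-P1-carry∞ (act-P1 g α))))

    cJ-surjective : Σ (P1 → P1 → Carrier) λ J → IsInvariantPseudoMeasure A J × (∀ g → cJ A J ∞ g ≈ f g)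
    cJ-surjective = ratio F , isInv , cJ≈f
      where
      F : P1 → Carrier
      F α = f (carry∞ α)
      isInv : IsInvariantPseudoMeasure A (ratio F)
      isInv = record
        { pseudo      = ratio-isPseudoMeasure F
        ; equivariant = ratio-equivariant {F} {f} cusp-carry∞-twisted
        }
      cJ≈f : ∀ g → f I \\ f (carry∞ (act-P1 g ∞)) ≈ f g
      cJ≈f g = begin
        f I \\ f (carry∞ (act-P1 g ∞))  ≈⟨ \\-cong₂ cocycle-I (cusp-∞-invariant g _ (≡.sym (act-P1-carry∞ _))) ⟩
        ε \\ f g                        ≈⟨ ∙-congʳ ε⁻¹≈ε ⟩
        ε ∙ f g                         ≈⟨ identityˡ (f g) ⟩
        f g                             ∎

proposition4p8p3 : ∀ {c ℓ : Level} (U : Group c ℓ) (A : SL2Action U) →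
    let open Group U
        open SL2Action A
        J0∞ = λ (J : P1 → P1 → Carrier) → J (fin ((+ 0) / 1)) ∞
    in
    -- (i)
    (∀ J → IsInvariantPseudoMeasure A J →
      (cJ A J ∞ σ ≈ J0∞ J) × (cJ A J ∞ τ ≈ J0∞ J) × InU₊ A (J0∞ J))
    ×
    -- (ii) J ↦ c^J_∞ is a bijection M_U(PSL(2,ℤ)) → Z¹(PSL(2,ℤ),U₊)_cusp
    -- (well-defined)
    ((∀ J → IsInvariantPseudoMeasure A J → IsCuspCocycle A (cJ A J ∞))
    -- (injective)
    × (∀ J J′ → IsInvariantPseudoMeasure A J → IsInvariantPseudoMeasure A J′ →
         (∀ g → cJ A J ∞ g ≈ cJ A J′ ∞ g) → ∀ α β → J α β ≈ J′ α β)
    -- (surjective)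
    × (∀ f → IsCuspCocycle A f →
         Σ (P1 → P1 → Carrier) λ J →
           IsInvariantPseudoMeasure A J × (∀ g → cJ A J ∞ g ≈ f g)))
proposition4p8p3 U A =
  -- σ∞ and τ∞ both compute to 0
  (λ J isInv → Group.refl U , Group.refl U , invariant⇒InU₊ A isInv _ ∞) ,
  (λ J → cJ-isCuspCocycle A) , (λ J J′ → cJ-injective A) , (λ f → cJ-surjective A)
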